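{- Let $G$ be a well-formed biconnected plane graph with poles $s$ and $t$, with right path $(w_0=s,w_1,\dots,w_k=t)$, let $e_1=(s,w_1)$, and let $G^*$ be the plane graph obtained by contracting $e_1$ in $G$. Let $\mathcal D^*$ be an inner-canonical orientation of $G^*$. Then the orientation $\mathcal D$ of $G$ obtained from $\mathcal D^*$ by orienting $e_1$ from $s$ to $w_1$ and keeping the orientation of every other edge unchanged is an inner-canonical orientation of $G$.
   Context: Graphs may have parallel edges but no self-loops. A plane graph is a planar graph with a fixed planar embedding and a designated outer face; a vertex is internal if it is not incident to the outer face. A graph is biconnected if it is connected and has no cut-vertex (a single edge or a set of parallel edges counts as biconnected). For two parallel edges $h_1,h_2$ with end-vertices $s,x$, $\ell(h_1,h_2)$ denotes the open bounded region of the plane bounded by $h_1$ and $h_2$; it is a multilens if it contains no vertex. A biconnected plane graph $G$ with two distinguished vertices $s,t$ (poles) is well-formed if: (WF1) $s$ and $t$ are incident to the outer face and $s$ immediately precedes $t$ in clockwise order along the cycle $C_o$ bounding the outer face; (WF2) every internal face has either two or three incident vertices; (WF3) all parallel edges, if any, are incident to $s$; (WF4) if $h_1,h_2$ are parallel edges with end-vertices $s$ and $x$ such that $\ell(h_1,h_2)$ is not a multilens, then there exist two parallel edges $h_1',h_2'$ between $s$ and a vertex $y\neq x$ such that $\ell(h_1',h_2')$ is a multilens and $\ell(h_1',h_2')\subset\ell(h_1,h_2)$. The right path of $G$ is the path from $s$ to $t$ obtained from $C_o$ by deleting the edge of $C_o$ joining $s$ and $t$. Contracting $e_1$ removes $e_1$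 and merges $s$ and $w_1$ into a single vertex, still called $s$, keeping all other edges (possibly creating parallel edges), with the clockwise order of edges around the new vertex being the clockwise order around $s$ following $e_1$ followed by the clockwise order around $w_1$ following $e_1$; thus the edges of $G^*$ correspond to the edges of $G$ other than $e_1$, and "keeping the orientation unchanged" means that an edge directed away from (towards) the merged vertex in $\mathcal D^*$ is directed away from (towards) its corresponding end-vertex $s$ or $w_1$ in $\mathcal D$. An $st$-orientation is an acyclic orientation whose unique source is $s$ and unique sink is $t$. An inner-canonical orientation of a well-formed biconnected plane graph with poles $s,t$ is an $st$-orientation in which every internal vertex has at least two incoming edges. -}

module Defs where

open import Data.Nat using (ℕ; zero; suc; _+_; _*_; _≤ᵇ_)
open import Data.Fin using (Fin; toℕ)
open import Data.Fin.Properties using (_≟_)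
open import Data.Bool using (Bool; true; false; not; _∧_; if_then_else_)
open import Data.Bool.Properties using () renaming (_≟_ to _≟B_)
open import Data.Product using (Σ; ∃; ∃-syntax; _×_; _,_; proj₁; proj₂)
open import Data.Product.Properties using (≡-dec)
open import Data.Sum using (_⊎_)
open import Data.Empty using (⊥)
open import Data.List using (List; length; filterᵇ; allFin; concatMap; _∷_; [])
open import Data.List.Membership.Propositional using (_∈_)
open import Data.List.Relation.Unary.Unique.Propositional using (Unique)
open import Relation.Nullary using (¬_)
open import Relation.Nullary.Decidable using (⌊_⌋)
open import Relation.Binary.PropositionalEquality using (_≡_; _≢_)
open import Relation.Binary.Construct.Closure.ReflexiveTransitive using (Star)
open import Relation.Binary.Construct.Closure.Transitive using (TransClosure)

-- Combinatorial maps (rotation systems) encoding embedded multigraphs.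
-- Edges are Fin m; edge e has a "source" end src e and a "target" end
-- tgt e (an arbitrary labelling, not an orientation).  A dart is an edge
-- together with a side: (e , false) starts at src e, (e , true) at tgt e.

Dart : ℕ → Set
Dart m = Fin m × Bool

iter : {A : Set} → (A → A) → ℕ → A → A
iter f zero    a = a
iter f (suc k) a = f (iter f k a)

tailOf : {n m : ℕ} → (Fin m → Fin n) → (Fin m → Fin n) → Dart m → Fin n
tailOf src tgt (e , false) = src e
tailOf src tgt (e , true)  = tgt e

rev : {m : ℕ} → Dart m → Dart m
rev (e , b) = (e , not b)

record CombMap : Set where
  field
    n m   : ℕ
    src tgt : Fin m → Fin n
    σ σ⁻  : Dart m → Dart m         -- σ d = next dart CLOCKWISE around tail d
    σσ⁻   : ∀ d → σ (σ⁻ d) ≡ d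
    σ⁻σ   : ∀ d → σ⁻ (σ d) ≡ d
    outer : Dart m                  -- a dart whose face (φ-orbit) is the outer face

  tail : Dart m → Fin n
  tail = tailOf src tgt

  α : Dart m → Dart m
  α = rev

  head : Dart m → Fin n
  head d = tail (α d)

  field
    σ-tail   : ∀ d → tail (σ d) ≡ tail d
    σ-cyclic : ∀ d d' → tail d ≡ tail d' → ∃[ k ] iter σ k d ≡ d'

  -- face permutation: traverse d, then take the next dart clockwise after
  -- the reverse of d; with σ clockwise, faces lie to the left, so the outer
  -- face boundary is traversed clockwise.
  φ : Dart m → Dart m
  φ d = σ (α d)

  SameFace : Dart m → Dart m → Set
  SameFace d d' = ∃[ k ] iter φ k d ≡ d'

  FaceVertex : Dart m → Fin n → Set
  FaceVertex d v = ∃[ k ] tail (iter φ k d) ≡ v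

  OuterDart : Dart m → Set
  OuterDart d = SameFace outer d

  OnOuter : Fin n → Set
  OnOuter v = FaceVertex outer v

  Internal : Fin n → Set
  Internal v = ¬ OnOuter v

  -- counting faces: a dart represents its face iff it is minimal in its orbit
  rank : Dart m → ℕ
  rank d = 2 * toℕ (proj₁ d) + (if proj₂ d then 1 else 0)

  darts : List (Dart m)
  darts = concatMap (λ e → (e , false) ∷ (e , true) ∷ []) (allFin m)

  minAux : ℕ → Dart m → Dart m → Bool
  minAux zero    d c = true
  minAux (suc k) d c = (rank d ≤ᵇ rank c) ∧ minAux k d (φ c)

  isFaceRep : Dart m → Bool
  isFaceRep d = minAux (2 * m) d d

  numFaces : ℕ
  numFaces = length (filterᵇ isFaceRep darts)

  NoSelfLoops : Set
  NoSelfLoops = ∀ e → src e ≢ tgt e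

  Adj : Fin n → Fin n → Set
  Adj u v = ∃[ d ] (tail d ≡ u × head d ≡ v)

  Connected : Set
  Connected = ∀ u v → Star Adj u v

  AdjAvoid : Fin n → Fin n → Fin n → Set
  AdjAvoid c u v = Adj u v × u ≢ c × v ≢ c

  IsCutVertex : Fin n → Set
  IsCutVertex c = ¬ (∀ u v → u ≢ c → v ≢ c → Star (AdjAvoid c) u v)

  Biconnected : Set
  Biconnected = Connected × (∀ c → ¬ IsCutVertex c)

  -- planar embedding (genus 0) for a connected map: Euler's formula
  IsPlane : Set
  IsPlane = Connected × (n + numFaces ≡ m + 2)

  EndsAre : Fin m → Fin n → Fin n → Set
  EndsAre e u v = (src e ≡ u × tgt e ≡ v) ⊎ (src e ≡ v × tgt e ≡ u)

  Parallel : Fin m → Fin m → Set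
  Parallel e e' = e ≢ e' × ((src e ≡ src e' × tgt e ≡ tgt e') ⊎ (src e ≡ tgt e' × tgt e ≡ src e'))

  edgeOf : Dart m → Fin m
  edgeOf = proj₁

  -- Regions ℓ(h₁,h₂): faces of the plane minus the closed curve h₁ ∪ h₂ are
  -- grouped into its two sides by moving along a face or across an edge
  -- other than h₁,h₂.  The faces inside ℓ(h₁,h₂) are those not reachable
  -- from the outer face.
  SideStep : Fin m → Fin m → Dart m → Dart m → Set
  SideStep h₁ h₂ d d' = (d' ≡ φ d) ⊎ (d' ≡ α d × edgeOf d ≢ h₁ × edgeOf d ≢ h₂)

  InLens : Fin m → Fin m → Dart m → Set
  InLens h₁ h₂ d = ¬ Star (SideStep h₁ h₂) outer d

  Multilens : Fin n → Fin n → Fin m → Fin m → Set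
  Multilens s x h₁ h₂ = ∀ d v → InLens h₁ h₂ d → FaceVertex d v → v ≢ s → v ≢ x → ⊥

  LensSubset : Fin m → Fin m → Fin m → Fin m → Set
  LensSubset h₁' h₂' h₁ h₂ = ∀ d → InLens h₁' h₂' d → InLens h₁ h₂ d

  WF1 : Fin n → Fin n → Set
  WF1 s t = OnOuter s × OnOuter t × ∃[ d ] (OuterDart d × tail d ≡ s × head d ≡ t)

  WF2 : Set
  WF2 = ∀ d → ¬ OuterDart d →
        ∃[ L ] (Unique L × (∀ v → (v ∈ L → FaceVertex d v) × (FaceVertex d v → v ∈ L))
                 × (length L ≡ 2 ⊎ length L ≡ 3))

  WF3 : Fin n → Set
  WF3 s = ∀ e e' → Parallel e e' → src e ≡ s ⊎ tgt e ≡ s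

  WF4 : Fin n → Set
  WF4 s = ∀ x h₁ h₂ → Parallel h₁ h₂ → EndsAre h₁ s x → ¬ Multilens s x h₁ h₂ →
          ∃[ y ] ∃[ h₁' ] ∃[ h₂' ] (y ≢ x × Parallel h₁' h₂' × EndsAre h₁' s y
             × Multilens s y h₁' h₂' × LensSubset h₁' h₂' h₁ h₂)

  WellFormed : Fin n → Fin n → Set
  WellFormed s t = NoSelfLoops × IsPlane × Biconnected × WF1 s t × WF2 × WF3 s × WF4 s

  -- orientations: edge e is directed along the dart (e , o e)
  Orientation : Set
  Orientation = Fin m → Bool

  tailO : Orientation → Fin m → Fin n
  tailO o e = tail (e , o e)

  headO : Orientation → Fin m → Fin n
  headO o e = head (e , o e)

  Arc : Orientation → Fin n → Fin n → Set
  Arc o u v = ∃[ e ] (tailO o e ≡ u × headO o e ≡ v)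

  Acyclic : Orientation → Set
  Acyclic o = ∀ v → ¬ TransClosure (Arc o) v v

  IsSource : Orientation → Fin n → Set
  IsSource o v = ∀ e → headO o e ≢ v

  IsSink : Orientation → Fin n → Set
  IsSink o v = ∀ e → tailO o e ≢ v

  IsStOrientation : Fin n → Fin n → Orientation → Set
  IsStOrientation s t o = Acyclic o × IsSource o s × (∀ v → IsSource o v → v ≡ s)
                                   × IsSink o t × (∀ v → IsSink o v → v ≡ t)

  IsInnerCanonical : Fin n → Fin n → Orientation → Set
  IsInnerCanonical s t o = IsStOrientation s t o ×
    (∀ v → Internal v → ∃[ e ] ∃[ e' ] (e ≢ e' × headO o e ≡ v × headO o e' ≡ v))

open CombMap

-- Contraction of the edge of dart p (with tail w and head s).
-- G* is described by: a vertex map π (identifying exactly s and w),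
-- an injective edge map ψ from edges of G* onto the edges of G other than
-- edge p (same end labelling), rotation as in the paper (around the merged
-- vertex: clockwise around s after e, then clockwise around w after e),
-- and outer face = the face containing the remaining darts of G's outer face.
module _ (G : CombMap) where
  jump : Dart (m G) → Dart (m G) → Dart (m G)
  jump p x = if ⌊ ≡-dec _≟_ _≟B_ x (α G p) ⌋ then σ G p
             else if ⌊ ≡-dec _≟_ _≟B_ x p ⌋ then σ G (α G p)
             else x

record IsContraction (G : CombMap) (p : Dart (m G)) (G* : CombMap) : Set where
  field
    π   : Fin (n G) → Fin (n G*)
    ψ   : Fin (m G*) → Fin (m G)
    π-surj   : ∀ v* → ∃[ v ] π v ≡ v*
    π-merge  : π (tail G p) ≡ π (head G p)
    π-inj    : ∀ u v → π u ≡ π v →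
                 u ≡ v ⊎ ((u ≡ tail G p ⊎ u ≡ head G p) × (v ≡ tail G p ⊎ v ≡ head G p))
    ψ-inj    : ∀ e₁ e₂ → ψ e₁ ≡ ψ e₂ → e₁ ≡ e₂
    ψ-avoid  : ∀ e* → ψ e* ≢ proj₁ p
    ψ-onto   : ∀ e → e ≢ proj₁ p → ∃[ e* ] ψ e* ≡ e
    src-ok   : ∀ e* → src G* e* ≡ π (src G (ψ e*))
    tgt-ok   : ∀ e* → tgt G* e* ≡ π (tgt G (ψ e*))

  liftD : Dart (m G*) → Dart (m G)
  liftD (e* , b) = (ψ e* , b)

  field
    σ-ok     : ∀ d* → liftD (σ G* d*) ≡ jump G p (jump G p (σ G (liftD d*)))
    outer-ok : OuterDart G (liftD (outer G*))

{-# OPTIONS --safe #-}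
-- The edges of G other than e₁ are exactly the edges of G*, oriented alike,
-- and π identifies only s with w₁.  Since e₁ runs from s to w₁ and the merged
-- vertex is the source of D*, every directed cycle of D avoids s and maps to
-- one of D*, and sources, sinks and in-degrees of vertices other than s and w₁
-- are read off from D*.  If w₁ were a sink, no path avoiding s could enter
-- w₁ (its last edge would enter either the source of D* or the sink w₁), so s
-- would separate w₁ from t.  Finally w₁ is not internal: φ is a permutation
-- of the finitely many darts, so the dart p from w₁ to s preceding the pole
-- dart s → t lies on the outer face.
module Submission where

open import Defs
open import Data.Nat using (ℕ; zero; suc; _+_; _*_)
open import Data.Nat.Properties using (n<1+n; m≤n⇒∃[o]m+o≡n; +-suc)
open import Data.Fin using (Fin; toℕ; combine)
open import Data.Fin.Properties using (_≟_; pigeonhole; combine-injective; 2↔Bool)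
open import Data.Bool using (true; false; not)
open import Data.Bool.Properties using (not-involutive) renaming (_≟_ to _≟B_)
open import Data.Product using (∃-syntax; _×_; _,_; proj₁)
open import Data.Product.Properties using (≡-dec)
open import Data.Sum using (_⊎_; inj₁; inj₂)
open import Data.Empty using (⊥-elim)
open import Function using (_∘_)
open import Function.Bundles using (Inverse)
open import Function.Definitions using (Injective)
open import Relation.Nullary using (¬_; yes; no)
open import Relation.Binary.PropositionalEquality
open import Relation.Binary.Construct.Closure.ReflexiveTransitive using (Star; ε; _◅_)
open import Relation.Binary.Construct.Closure.Transitive using (TransClosure; [_]; _∷_)

iter-+ : ∀ {A : Set} (f : A → A) m n x → iter f (m + n) x ≡ iter f m (iter f n x)
iter-+ f zero    n x = refl
iter-+ f (suc m) n x = cong f (iter-+ f m n x)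

iter-injective : ∀ {A : Set} {f : A → A} → Injective _≡_ _≡_ f →
                 ∀ k → Injective _≡_ _≡_ (iter f k)
iter-injective f-inj zero    eq = eq
iter-injective f-inj (suc k) eq = iter-injective f-inj k (f-inj eq)

module FiniteOrbit {A : Set} {N : ℕ} {code : A → Fin N} (code-inj : Injective _≡_ _≡_ code)
                   {f : A → A} (f-inj : Injective _≡_ _≡_ f) where
  open ≡-Reasoning

  iter-periodic : ∀ x → ∃[ ℓ ] iter f (suc ℓ) x ≡ x
  iter-periodic x =
    let i , j , i<j , same = pigeonhole (n<1+n N) (λ i → code (iter f (toℕ i) x))
        ℓ , i+1+ℓ≡j = m≤n⇒∃[o]m+o≡n i<j
    in ℓ , sym (iter-injective f-inj (toℕ i) (begin
          iter f (toℕ i) x                  ≡⟨ code-inj same ⟩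
          iter f (toℕ j) x                  ≡⟨ cong (λ k → iter f k x) (sym (trans (+-suc (toℕ i) ℓ) i+1+ℓ≡j)) ⟩
          iter f (toℕ i + suc ℓ) x          ≡⟨ iter-+ f (toℕ i) (suc ℓ) x ⟩
          iter f (toℕ i) (iter f (suc ℓ) x) ∎))

  orbit-preimage : ∀ {x y} → ∃[ k ] iter f k x ≡ f y → ∃[ k ] iter f k x ≡ y
  orbit-preimage {x} {y} (k , fᵏx≡fy) with ℓ , period ← iter-periodic x = k + ℓ , f-inj (begin
    iter f (suc (k + ℓ)) x      ≡⟨ cong (λ n → iter f n x) (sym (+-suc k ℓ)) ⟩
    iter f (k + suc ℓ) x        ≡⟨ iter-+ f k (suc ℓ) x ⟩
    iter f k (iter f (suc ℓ) x) ≡⟨ cong (iter f k) period ⟩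
    iter f k x                  ≡⟨ fᵏx≡fy ⟩
    f y                         ∎)

dartCode : ∀ {m} → Dart m → Fin (m * 2)
dartCode (e , b) = combine e (Inverse.from 2↔Bool b)

dartCode-injective : ∀ {m} → Injective _≡_ _≡_ (dartCode {m})
dartCode-injective {x = e , b} {e′ , b′} eq with combine-injective e _ e′ _ eq
... | refl , from-b≡from-b′ = cong (e ,_) (begin
  b                  ≡⟨ sym (strictlyInverseˡ b) ⟩
  to (from b)        ≡⟨ cong to from-b≡from-b′ ⟩
  to (from b′)       ≡⟨ strictlyInverseˡ b′ ⟩
  b′                 ∎)
  where open ≡-Reasoning
        open Inverse 2↔Bool

rev-involutive : ∀ {m} (d : Dart m) → rev (rev d) ≡ d
rev-involutive (e , b) = cong (e ,_) (not-involutive b)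

HasTwoIncoming : (G : CombMap) → CombMap.Orientation G → Fin (CombMap.n G) → Set
HasTwoIncoming G o v =
  ∃[ e ] ∃[ e′ ] (e ≢ e′ × CombMap.headO G o e ≡ v × CombMap.headO G o e′ ≡ v)

module _ (G : CombMap) where
  open CombMap G

  tail-φ : ∀ d → tail (φ d) ≡ head d
  tail-φ d = σ-tail (α d)

  tail≢head : NoSelfLoops → ∀ d → tail d ≢ head d
  tail≢head loopless (e , false) eq = loopless e eq
  tail≢head loopless (e , true)  eq = loopless e (sym eq)

  edge-ends : ∀ d b → (tail (edgeOf d , b) ≡ tail d × head (edgeOf d , b) ≡ head d)
                    ⊎ (tail (edgeOf d , b) ≡ head d × head (edgeOf d , b) ≡ tail d)
  edge-ends (e , false) false = inj₁ (refl , refl)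
  edge-ends (e , false) true  = inj₂ (refl , refl)
  edge-ends (e , true)  false = inj₂ (refl , refl)
  edge-ends (e , true)  true  = inj₁ (refl , refl)

  φ-injective : Injective _≡_ _≡_ φ
  φ-injective {x} {y} eq = begin
    x         ≡⟨ sym (rev-involutive x) ⟩
    α (α x)   ≡⟨ cong α (trans (sym (σ⁻σ (α x))) (trans (cong σ⁻ eq) (σ⁻σ (α y)))) ⟩
    α (α y)   ≡⟨ rev-involutive y ⟩
    y         ∎
    where open ≡-Reasoning

  sameFace-trans : ∀ {d d′ d″} → SameFace d d′ → SameFace d′ d″ → SameFace d d″
  sameFace-trans {d} (j , refl) (k , refl) = k + j , iter-+ φ k j d

  sameFace-preimage : ∀ {d d′} → SameFace d (φ d′) → SameFace d d′
  sameFace-preimage = FiniteOrbit.orbit-preimage dartCode-injective φ-injective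

  onOuter-tail : ∀ {d} → OuterDart d → OnOuter (tail d)
  onOuter-tail (k , eq) = k , cong tail eq

  internal≢onOuter : ∀ {u v} → Internal v → OnOuter u → v ≢ u
  internal≢onOuter v-internal u-outer refl = v-internal u-outer

module Contraction {G : CombMap} {p : Dart (CombMap.m G)} {G* : CombMap}
                   (C : IsContraction G p G*) where
  open CombMap G
  module G* = CombMap G*
  open IsContraction C

  tail-liftD : ∀ d* → G*.tail d* ≡ π (tail (liftD d*))
  tail-liftD (e* , false) = src-ok e*
  tail-liftD (e* , true)  = tgt-ok e*

  π-injective-off : ∀ {u v} → v ≢ tail p → v ≢ head p → π u ≡ π v → u ≡ v
  π-injective-off v≢w v≢s eq with π-inj _ _ eq
  ... | inj₁ u≡v                  = u≡v
  ... | inj₂ (_ , inj₁ v≡w)       = ⊥-elim (v≢w v≡w)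
  ... | inj₂ (_ , inj₂ v≡s)       = ⊥-elim (v≢s v≡s)

  edge-split : ∀ e → e ≡ edgeOf p ⊎ ∃[ e* ] ψ e* ≡ e
  edge-split e with e ≟ edgeOf p
  ... | yes e≡e₁ = inj₁ e≡e₁
  ... | no  e≢e₁ = inj₂ (ψ-onto e e≢e₁)

  sameFace-jump : ∀ d → SameFace d (jump G p d)
  sameFace-jump d with ≡-dec _≟_ _≟B_ d (α p)
  ... | yes refl = 1 , cong σ (rev-involutive p)
  ... | no _ with ≡-dec _≟_ _≟B_ d p
  ...   | yes refl = 1 , refl
  ...   | no _     = 0 , refl

  liftD-φ : ∀ d* → SameFace (liftD d*) (liftD (G*.φ d*))
  liftD-φ d* = subst (SameFace (liftD d*)) (sym (σ-ok (G*.α d*)))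
    (sameFace-trans G (1 , refl) (sameFace-trans G (sameFace-jump _) (sameFace-jump _)))

  liftD-iter : ∀ k d* → SameFace (liftD d*) (liftD (iter G*.φ k d*))
  liftD-iter zero    d* = 0 , refl
  liftD-iter (suc k) d* = sameFace-trans G (liftD-iter k d*) (liftD-φ _)

  liftD-outer : ∀ {d*} → G*.OuterDart d* → OuterDart (liftD d*)
  liftD-outer (k , refl) = sameFace-trans G outer-ok (liftD-iter k G*.outer)

  internal-π : ∀ {v} → v ≢ tail p → v ≢ head p → Internal v → G*.Internal (π v)
  internal-π v≢w v≢s v-internal (k , eq) with j , lift≡ ← liftD-outer (k , refl) =
    v-internal (j , trans (cong tail lift≡)
                          (π-injective-off v≢w v≢s (trans (sym (tail-liftD (iter G*.φ k G*.outer))) eq)))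

  module Oriented {D : Orientation} {D* : G*.Orientation} (agree : ∀ e* → D (ψ e*) ≡ D* e*) where
    tailO-ψ : ∀ e* → G*.tailO D* e* ≡ π (tailO D (ψ e*))
    tailO-ψ e* = trans (tail-liftD (e* , D* e*)) (cong (λ b → π (tail (ψ e* , b))) (sym (agree e*)))

    headO-ψ : ∀ e* → G*.headO D* e* ≡ π (headO D (ψ e*))
    headO-ψ e* = trans (tail-liftD (e* , not (D* e*)))
                       (cong (λ b → π (tail (ψ e* , not b))) (sym (agree e*)))

module Extension {G : CombMap} {p : Dart (CombMap.m G)} {G* : CombMap} (C : IsContraction G p G*)
                 {D : CombMap.Orientation G} {D* : CombMap.Orientation G*}
                 (agree : ∀ e* → D (IsContraction.ψ C e*) ≡ D* e*)
                 {s : Fin (CombMap.n G)} (p-to-s : CombMap.head G p ≡ s)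
                 (loopless : CombMap.NoSelfLoops G)
                 (e₁-from-s : CombMap.tailO G D (proj₁ p) ≡ s) where
  open CombMap G
  open IsContraction C
  open Contraction C
  open Oriented {D} {D*} agree

  w≢s : tail p ≢ s
  w≢s w≡s = tail≢head G loopless p (trans w≡s (sym p-to-s))

  e₁-to-w : headO D (edgeOf p) ≡ tail p
  e₁-to-w with edge-ends G p (D (edgeOf p))
  ... | inj₁ (tail≡w , _) = ⊥-elim (w≢s (trans (sym tail≡w) e₁-from-s))
  ... | inj₂ (_ , head≡w) = head≡w

  ≢s⇒≢head : ∀ {v} → v ≢ s → v ≢ head p
  ≢s⇒≢head v≢s v≡hp = v≢s (trans v≡hp p-to-s)

  module _ {v} (v≢w : v ≢ tail p) (v≢s : v ≢ s) where
    π-injective-at : ∀ {u} → π u ≡ π v → u ≡ v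
    π-injective-at = π-injective-off v≢w (≢s⇒≢head v≢s)

    tailO-reflect : ∀ e* → G*.tailO D* e* ≡ π v → tailO D (ψ e*) ≡ v
    tailO-reflect e* eq = π-injective-at (trans (sym (tailO-ψ e*)) eq)

    headO-reflect : ∀ e* → G*.headO D* e* ≡ π v → headO D (ψ e*) ≡ v
    headO-reflect e* eq = π-injective-at (trans (sym (headO-ψ e*)) eq)

  module _ (s-source* : G*.IsSource D* (π s)) where
    s-source : IsSource D s
    s-source e e-to-s with edge-split e
    ... | inj₁ refl        = w≢s (trans (sym e₁-to-w) e-to-s)
    ... | inj₂ (e* , refl) = s-source* e* (trans (headO-ψ e*) (cong π e-to-s))

    arc-target≢s : ∀ {u x} → Arc D u x → x ≢ s
    arc-target≢s (e , _ , e-to-x) x≡s = s-source e (trans e-to-x x≡s)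

    reach-target≢s : ∀ {u x} → TransClosure (Arc D) u x → x ≢ s
    reach-target≢s [ a ]   = arc-target≢s a
    reach-target≢s (_ ∷ r) = reach-target≢s r

    arc-π : ∀ {u x} → Arc D u x → u ≢ s → G*.Arc D* (π u) (π x)
    arc-π (e , e-from-u , e-to-x) u≢s with edge-split e
    ... | inj₁ refl        = ⊥-elim (u≢s (trans (sym e-from-u) e₁-from-s))
    ... | inj₂ (e* , refl) = e* , trans (tailO-ψ e*) (cong π e-from-u)
                                , trans (headO-ψ e*) (cong π e-to-x)

    reach-π : ∀ {u x} → TransClosure (Arc D) u x → u ≢ s → TransClosure (G*.Arc D*) (π u) (π x)
    reach-π [ a ]   u≢s = [ arc-π a u≢s ]
    reach-π (a ∷ r) u≢s = arc-π a u≢s ∷ reach-π r (arc-target≢s a)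

    acyclic : G*.Acyclic D* → Acyclic D
    acyclic acyclic* v cycle = acyclic* (π v) (reach-π cycle (reach-target≢s cycle))

    no-step-into-sink : IsSink D (tail p) → ∀ {u x} → u ≢ tail p → AdjAvoid s u x → x ≢ tail p
    no-step-into-sink w-sink u≢w (((e , b) , d-from-u , d-to-x) , u≢s , _) x≡w with edge-split e
    ... | inj₁ refl with edge-ends G p b
    ...   | inj₁ (tail≡w , _) = u≢w (trans (sym d-from-u) tail≡w)
    ...   | inj₂ (tail≡s , _) = u≢s (trans (sym d-from-u) (trans tail≡s p-to-s))
    no-step-into-sink w-sink u≢w (((e , b) , d-from-u , d-to-x) , u≢s , _) x≡w | inj₂ (e* , refl)
      with edge-ends G (e , b) (D e)
    ... | inj₁ (_ , e-to-x) = s-source* e* (begin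
            G*.headO D* e*    ≡⟨ headO-ψ e* ⟩
            π (headO D e)     ≡⟨ cong π (trans e-to-x (trans d-to-x x≡w)) ⟩
            π (tail p)        ≡⟨ π-merge ⟩
            π (head p)        ≡⟨ cong π p-to-s ⟩
            π s               ∎)
      where open ≡-Reasoning
    ... | inj₂ (e-from-x , _) = w-sink e (trans e-from-x (trans d-to-x x≡w))

    unreachable-sink : IsSink D (tail p) →
                       ∀ {u x} → Star (AdjAvoid s) u x → u ≢ tail p → x ≢ tail p
    unreachable-sink w-sink ε            u≢w = u≢w
    unreachable-sink w-sink (adj ◅ path) u≢w =
      unreachable-sink w-sink path (no-step-into-sink w-sink u≢w adj)

    w-not-sink : Biconnected → ∀ {t} → t ≢ s → t ≢ tail p → ¬ IsSink D (tail p)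
    w-not-sink (_ , no-cut) t≢s t≢w w-sink =
      no-cut s (λ avoiding → unreachable-sink w-sink (avoiding _ _ t≢s w≢s) t≢w refl)

  source-unique : (∀ v* → G*.IsSource D* v* → v* ≡ π s) → ∀ v → IsSource D v → v ≡ s
  source-unique sources* v v-source with v ≟ s
  ... | yes v≡s = v≡s
  ... | no  v≢s = ⊥-elim (v≢s (sym (π-injective-at v≢w v≢s (sym (sources* (π v) v-source*)))))
    where
    v≢w : v ≢ tail p
    v≢w v≡w = v-source (edgeOf p) (trans e₁-to-w (sym v≡w))
    v-source* : G*.IsSource D* (π v)
    v-source* e* eq = v-source (ψ e*) (headO-reflect v≢w v≢s e* eq)

  t-sink : ∀ {t} → t ≢ s → G*.IsSink D* (π t) → IsSink D t
  t-sink t≢s t-sink* e e-from-t with edge-split e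
  ... | inj₁ refl        = t≢s (trans (sym e-from-t) e₁-from-s)
  ... | inj₂ (e* , refl) = t-sink* e* (trans (tailO-ψ e*) (cong π e-from-t))

  sink-unique : Biconnected → G*.IsSource D* (π s) → ∀ {t} → t ≢ s →
                (∀ v* → G*.IsSink D* v* → v* ≡ π t) → ∀ v → IsSink D v → v ≡ t
  sink-unique biconnected s-source* {t} t≢s sinks* v v-sink with v ≟ t
  ... | yes v≡t = v≡t
  ... | no  v≢t with v ≟ tail p
  ...   | yes refl = ⊥-elim (w-not-sink s-source* biconnected t≢s (v≢t ∘ sym) v-sink)
  ...   | no  v≢w  = ⊥-elim (v≢t (sym (π-injective-at v≢w v≢s (sym (sinks* (π v) v-sink*)))))
    where
    v≢s : v ≢ s
    v≢s v≡s = v-sink (edgeOf p) (trans e₁-from-s (sym v≡s))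
    v-sink* : G*.IsSink D* (π v)
    v-sink* e* eq = v-sink (ψ e*) (tailO-reflect v≢w v≢s e* eq)

  twoIncoming : ∀ {v} → v ≢ tail p → v ≢ s → HasTwoIncoming G* D* (π v) → HasTwoIncoming G D v
  twoIncoming v≢w v≢s (e* , e′* , e*≢e′* , e*-to-v , e′*-to-v) =
    ψ e* , ψ e′* , e*≢e′* ∘ ψ-inj e* e′* ,
    headO-reflect v≢w v≢s e* e*-to-v , headO-reflect v≢w v≢s e′* e′*-to-v

  internal-twoIncoming : OnOuter (tail p) → OnOuter s →
                         (∀ v* → G*.Internal v* → HasTwoIncoming G* D* v*) →
                         ∀ v → Internal v → HasTwoIncoming G D v
  internal-twoIncoming w-outer s-outer incoming* v v-internal =
    twoIncoming v≢w v≢s (incoming* (π v) (internal-π v≢w (≢s⇒≢head v≢s) v-internal))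
    where
    v≢w : v ≢ tail p
    v≢w = internal≢onOuter G v-internal w-outer
    v≢s : v ≢ s
    v≢s = internal≢onOuter G v-internal s-outer

  innerCanonical : Biconnected → OnOuter (tail p) → OnOuter s → ∀ {t} → t ≢ s →
                   G*.IsInnerCanonical (π s) (π t) D* → IsInnerCanonical s t D
  innerCanonical biconnected w-outer s-outer t≢s
                 ((acyclic* , s-source* , sources* , t-sink* , sinks*) , incoming*) =
    ( acyclic s-source* acyclic* , s-source s-source* , source-unique sources*
    , t-sink t≢s t-sink* , sink-unique biconnected s-source* t≢s sinks* )
    , internal-twoIncoming w-outer s-outer incoming*

lemma11 : (G : CombMap) (s t : Fin (CombMap.n G))
    → CombMap.WellFormed G s t
    → (d₀ p : Dart (CombMap.m G))
    → CombMap.OuterDart G d₀ → CombMap.tail G d₀ ≡ s → CombMap.head G d₀ ≡ t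
    → CombMap.φ G p ≡ d₀
    → (G* : CombMap) (C : IsContraction G p G*)
    → (D* : CombMap.Orientation G*)
    → CombMap.IsInnerCanonical G* (IsContraction.π C s) (IsContraction.π C t) D*
    → (D : CombMap.Orientation G)
    → CombMap.tailO G D (proj₁ p) ≡ s
    → (∀ e* → D (IsContraction.ψ C e*) ≡ D* e*)
    → CombMap.IsInnerCanonical G s t D
lemma11 G s t (loopless , _ , biconnected , (s-outer , _) , _) d₀ p d₀-outer d₀-from-s d₀-to-t
        φp≡d₀ G* C D* D*-canonical D e₁-from-s agree =
  Extension.innerCanonical C {D} {D*} agree p-to-s loopless e₁-from-s
    biconnected w-outer s-outer t≢s D*-canonical
  where
  open CombMap G
  p-to-s : head p ≡ s
  p-to-s = trans (sym (tail-φ G p)) (trans (cong tail φp≡d₀) d₀-from-s)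
  w-outer : OnOuter (tail p)
  w-outer = onOuter-tail G (sameFace-preimage G (subst (SameFace outer) (sym φp≡d₀) d₀-outer))
  t≢s : t ≢ s
  t≢s t≡s = tail≢head G loopless d₀ (trans d₀-from-s (trans (sym t≡s) (sym d₀-to-t)))
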